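{- Let $n\geq 17$. In any tiling of a $9\times n$ rectangle by $T$-tetrominos and monominos, every $9\times 17$ box (i.e., the set of all cells lying in any seventeen consecutive columns of the rectangle) contains at least one monomino.
   Context: The $T$-tetromino is the polyomino formed by four unit squares: three in a row together with a fourth square attached to the middle square of that row. A tiling of a $9\times n$ rectangle (9 rows, $n$ columns of unit cells) by $T$-tetrominos and monominos is a partition of its cells into copies of the $T$-tetromino (in any rotation or reflection, aligned with the grid) and single cells (monominos). -}

module Defs where

open import Data.Nat using (ℕ; suc; _+_; _<_; _≤_)
open import Data.Product using (_×_; _,_; ∃-syntax)
open import Data.List using (List; []; _∷_; concatMap)
open import Data.List.Membership.Propositional using (_∈_)
open import Data.List.Relation.Unary.All using (All)
open import Data.List.Relation.Unary.Unique.Propositional using (Unique)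

-- A cell is (row , column), rows and columns indexed from 0.
Cell : Set
Cell = ℕ × ℕ

-- The four orientations of the T-tetromino (the T-tetromino is
-- reflection-symmetric, so rotations already give all reflections).
data Orientation : Set where
  stemDown stemUp stemRight stemLeft : Orientation

-- A tile: a monomino at a cell, or a T-tetromino with an orientation,
-- placed with the top-left corner of its bounding box at (r , c).
data Tile : Set where
  mono : Cell → Tile
  tee  : Orientation → Cell → Tile

cells : Tile → List Cell
cells (mono x) = x ∷ []
cells (tee stemDown  (r , c)) =
  (r , c) ∷ (r , suc c) ∷ (r , suc (suc c)) ∷ (suc r , suc c) ∷ []
cells (tee stemUp    (r , c)) =
  (suc r , c) ∷ (suc r , suc c) ∷ (suc r , suc (suc c)) ∷ (r , suc c) ∷ []
cells (tee stemRight (r , c)) =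
  (r , c) ∷ (suc r , c) ∷ (suc (suc r) , c) ∷ (suc r , suc c) ∷ []
cells (tee stemLeft  (r , c)) =
  (r , suc c) ∷ (suc r , suc c) ∷ (suc (suc r) , suc c) ∷ (suc r , c) ∷ []

InRect : ℕ → ℕ → Cell → Set
InRect m n (r , c) = r < m × c < n

record IsTiling (m n : ℕ) (ts : List Tile) : Set where
  field
    inside   : All (InRect m n) (concatMap cells ts)
    disjoint : Unique (concatMap cells ts)
    covers   : ∀ (x : Cell) → InRect m n x → x ∈ concatMap cells ts

module Submission where

-- The proof is a verified exhaustive search in the style of a transfer matrix.
-- Suppose the box of columns j .. j + 16 contains no monomino and scan it column by
-- column.  Before box column k, the state is a profile: which cells of the board
-- columns k + j and k + j + 1 are already covered by tiles starting further left.
-- Covering column k + j from top to bottom, each cell still free must be covered by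
-- a T-tetromino whose position is one of finitely many candidates (in column j such
-- a tetromino may also stick in from the left).  This gives a search `reachable`,
-- for boards with any number of rows, whose k-th list contains every profile that
-- can really occur before box column k (`Scan.reach`).  For 9 rows the list after
-- 17 columns is empty, which is checked by evaluation (`no-survivors`).

open import Defs
open import Data.Bool using (Bool; true; false; not; _∧_; if_then_else_)
open import Data.Bool.Properties using (¬-not)
open import Data.Nat using (ℕ; zero; suc; _+_; _∸_; _≤_; _<_; z≤n; s≤s; _≤?_; _<?_; _≡ᵇ_)
open import Data.Nat.Properties
open import Data.Product using (_×_; _,_; proj₁; proj₂; ∃-syntax)
open import Data.Sum using (_⊎_; inj₁; inj₂; map₂)
open import Data.List using (List; []; _∷_; _++_; map; concatMap; foldr; filter)
open import Data.List.Membership.Propositional using (_∈_; find; lose)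
open import Data.List.Membership.Propositional.Properties
  using (∈-map⁺; ∈-map⁻; ∈-++⁺ˡ; ∈-++⁺ʳ; ∈-concatMap⁺; ∈-concatMap⁻; ∈-filter⁺)
open import Data.List.Relation.Unary.Any using (here; there; any?)
open import Data.List.Relation.Unary.All using (All; all?)
import Data.List.Relation.Unary.All as All
open import Data.List.Relation.Unary.AllPairs using (_∷_)
open import Data.List.Relation.Unary.Unique.Propositional using (Unique)
open import Data.Vec using (Vec; []; _∷_; replicate; splitAt) renaming (_++_ to _++ᵛ_)
open import Data.Vec.Properties using (++-injectiveˡ; ++-injectiveʳ)
open import Data.Empty using (⊥; ⊥-elim)
open import Function using (_∘_)
open import Function.Bundles using (_⇔_; mk⇔; Equivalence)
open import Relation.Unary using (Decidable)
open import Relation.Nullary using (¬_; yes; no)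
open import Relation.Nullary.Decidable using (from-yes; _×-dec_)
open import Relation.Binary.PropositionalEquality

open Equivalence using (to; from)

offsets : Orientation → List Cell
offsets o = cells (tee o (0 , 0))

translate : Cell → Cell → Cell
translate (r0 , c0) (dr , dc) = (dr + r0 , dc + c0)

cells-tee : ∀ o p → cells (tee o p) ≡ map (translate p) (offsets o)
cells-tee stemDown  _ = refl
cells-tee stemUp    _ = refl
cells-tee stemRight _ = refl
cells-tee stemLeft  _ = refl

∈-tee⁻ : ∀ o p {x} → x ∈ cells (tee o p) → ∃[ d ] d ∈ offsets o × x ≡ translate p d
∈-tee⁻ o p x∈ = ∈-map⁻ (translate p) (subst (_ ∈_) (cells-tee o p) x∈)

∈-tee⁺ : ∀ o p {d} → d ∈ offsets o → translate p d ∈ cells (tee o p)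
∈-tee⁺ o p d∈ = subst (_ ∈_) (sym (cells-tee o p)) (∈-map⁺ (translate p) d∈)

width : Orientation → ℕ
width stemDown  = 2
width stemUp    = 2
width stemRight = 1
width stemLeft  = 1

width≤2 : ∀ o → width o ≤ 2
width≤2 stemDown  = ≤-refl
width≤2 stemUp    = ≤-refl
width≤2 stemRight = s≤s z≤n
width≤2 stemLeft  = s≤s z≤n

offsets-within : ∀ o → All (λ d → proj₂ d ≤ width o) (offsets o)
offsets-within stemDown  = from-yes (all? (λ d → proj₂ d ≤? 2) (offsets stemDown))
offsets-within stemUp    = from-yes (all? (λ d → proj₂ d ≤? 2) (offsets stemUp))
offsets-within stemRight = from-yes (all? (λ d → proj₂ d ≤? 1) (offsets stemRight))
offsets-within stemLeft  = from-yes (all? (λ d → proj₂ d ≤? 1) (offsets stemLeft))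

column-witness : ∀ o {e} → e ≤ width o → ∃[ i ] (i , e) ∈ offsets o
column-witness stemDown  z≤n             = 0 , here refl
column-witness stemDown  (s≤s z≤n)       = 0 , there (here refl)
column-witness stemDown  (s≤s (s≤s z≤n)) = 0 , there (there (here refl))
column-witness stemUp    z≤n             = 1 , here refl
column-witness stemUp    (s≤s z≤n)       = 0 , there (there (there (here refl)))
column-witness stemUp    (s≤s (s≤s z≤n)) = 1 , there (there (here refl))
column-witness stemRight z≤n             = 0 , here refl
column-witness stemRight (s≤s z≤n)       = 1 , there (there (there (here refl)))
column-witness stemLeft  z≤n             = 1 , there (there (there (here refl)))
column-witness stemLeft  (s≤s z≤n)       = 0 , here refl

leftCol : Tile → ℕ
leftCol (mono (_ , c))  = c
leftCol (tee _ (_ , c)) = c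

col-bounds : ∀ t {i c} → (i , c) ∈ cells t → leftCol t ≤ c × c ≤ 2 + leftCol t
col-bounds (mono _) (here refl) = ≤-refl , m≤n+m _ 2
col-bounds (tee o p@(r0 , c0)) x∈ with ∈-tee⁻ o p x∈
... | (dr , dc) , d∈ , refl =
  m≤n+m c0 dc , +-monoˡ-≤ c0 (≤-trans (All.lookup (offsets-within o) d∈) (width≤2 o))

spans : ∀ t {i c} c' → (i , c) ∈ cells t → leftCol t ≤ c' → c' ≤ c → ∃[ i' ] (i' , c') ∈ cells t
spans (mono (r , c)) c' (here refl) lo hi with ≤-antisym lo hi
... | refl = r , here refl
spans (tee o p@(r0 , c0)) c' x∈ lo hi with ∈-tee⁻ o p x∈
... | (dr , dc) , d∈ , refl with column-witness o (≤-trans (∸-monoˡ-≤ c0 hi) dc≤width)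
  where
  dc≤width : dc + c0 ∸ c0 ≤ width o
  dc≤width = ≤-trans (≤-reflexive (m+n∸n≡m dc c0)) (All.lookup (offsets-within o) d∈)
... | i , e∈ = i + r0 , subst (λ c → (i + r0 , c) ∈ _) (m∸n+n≡m lo) (∈-tee⁺ o p e∈)

-- Moving a tetromino horizontally moves each of its cells by the same amount
-- (stated for shifts u, v so that it needs no subtraction).
shift-tee : ∀ o r0 {c0 c0' u v} → c0' + u ≡ c0 + v →
  ∀ {i c} → (i , c) ∈ cells (tee o (r0 , c0)) → ∃[ w ] (i , w) ∈ cells (tee o (r0 , c0')) × w + u ≡ c + v
shift-tee o r0 {c0} {c0'} {u} {v} eq x∈ with ∈-tee⁻ o (r0 , c0) x∈
... | (dr , dc) , d∈ , refl = dc + c0' , ∈-tee⁺ o (r0 , c0') d∈ , moved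
  where
  moved : dc + c0' + u ≡ dc + c0 + v
  moved = trans (+-assoc dc c0' u) (trans (cong (dc +_) eq) (sym (+-assoc dc c0 v)))

unique-++-disjoint : ∀ {A : Set} (xs : List A) {ys x} → Unique (xs ++ ys) → x ∈ xs → x ∈ ys → ⊥
unique-++-disjoint (_ ∷ xs) (x∉ ∷ _) (here refl) x∈ys = All.lookup x∉ (∈-++⁺ʳ xs x∈ys) refl
unique-++-disjoint (_ ∷ xs) (_ ∷ u) (there x∈xs) x∈ys = unique-++-disjoint xs u x∈xs x∈ys

unique-++ʳ : ∀ {A : Set} (xs : List A) {ys} → Unique (xs ++ ys) → Unique ys
unique-++ʳ []       u       = u
unique-++ʳ (_ ∷ xs) (_ ∷ u) = unique-++ʳ xs u

∈-tiles⁺ : ∀ {ts t x} → t ∈ ts → x ∈ cells t → x ∈ concatMap cells ts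
∈-tiles⁺ t∈ x∈ = ∈-concatMap⁺ cells (lose t∈ x∈)

∈-tiles⁻ : ∀ {ts x} → x ∈ concatMap cells ts → ∃[ t ] t ∈ ts × x ∈ cells t
∈-tiles⁻ {ts} x∈ = find (∈-concatMap⁻ cells {xs = ts} x∈)

tile-unique : ∀ {ts t t' x} → Unique (concatMap cells ts) → t ∈ ts → t' ∈ ts →
  x ∈ cells t → x ∈ cells t' → t ≡ t'
tile-unique {t ∷ ts} u (here refl) (here refl) x∈ x∈' = refl
tile-unique {t ∷ ts} u (here refl) (there t'∈) x∈ x∈' =
  ⊥-elim (unique-++-disjoint (cells t) u x∈ (∈-tiles⁺ t'∈ x∈'))
tile-unique {t ∷ ts} u (there t∈) (here refl) x∈ x∈' =
  ⊥-elim (unique-++-disjoint (cells t) u x∈' (∈-tiles⁺ t∈ x∈))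
tile-unique {t ∷ ts} u (there t∈) (there t'∈) x∈ x∈' =
  tile-unique (unique-++ʳ (cells t) u) t∈ t'∈ x∈ x∈'

module TilingFacts {m n ts} (T : IsTiling m n ts) where
  open IsTiling T

  tile-at : ∀ {x} → InRect m n x → ∃[ t ] t ∈ ts × x ∈ cells t
  tile-at x∈R = ∈-tiles⁻ (covers _ x∈R)

  tile-inside : ∀ {t x} → t ∈ ts → x ∈ cells t → InRect m n x
  tile-inside t∈ x∈ = All.lookup inside (∈-tiles⁺ t∈ x∈)

  same-tile : ∀ {t t' x} → t ∈ ts → t' ∈ ts → x ∈ cells t → x ∈ cells t' → t ≡ t'
  same-tile = tile-unique disjoint

-- Bit i of a bit vector; positions past the end read as set, so that the
-- search below never places anything outside the board.
isSet : ∀ {m} → Vec Bool m → ℕ → Bool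
isSet []      _       = true
isSet (b ∷ v) zero    = b
isSet (b ∷ v) (suc i) = isSet v i

setBit : ∀ {m} → Vec Bool m → ℕ → Vec Bool m
setBit []      _       = []
setBit (b ∷ v) zero    = true ∷ v
setBit (b ∷ v) (suc i) = b ∷ setBit v i

setBit-self : ∀ {m} (v : Vec Bool m) i → isSet (setBit v i) i ≡ true
setBit-self []      i       = refl
setBit-self (b ∷ v) zero    = refl
setBit-self (b ∷ v) (suc i) = setBit-self v i

setBit-keep : ∀ {m} (v : Vec Bool m) p i → isSet v i ≡ true → isSet (setBit v p) i ≡ true
setBit-keep []      p       i       set = refl
setBit-keep (b ∷ v) zero    zero    set = refl
setBit-keep (b ∷ v) zero    (suc i) set = set
setBit-keep (b ∷ v) (suc p) zero    set = set
setBit-keep (b ∷ v) (suc p) (suc i) set = setBit-keep v p i set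

setBit-new : ∀ {m} (v : Vec Bool m) p i → isSet (setBit v p) i ≡ true → isSet v i ≡ true ⊎ i ≡ p
setBit-new []      p       i       set = inj₁ refl
setBit-new (b ∷ v) zero    zero    set = inj₂ refl
setBit-new (b ∷ v) zero    (suc i) set = inj₁ set
setBit-new (b ∷ v) (suc p) zero    set = inj₁ set
setBit-new (b ∷ v) (suc p) (suc i) set = map₂ (cong suc) (setBit-new v p i set)

empty-unset : ∀ {m i} → i < m → isSet (replicate m false) i ≢ true
empty-unset {suc m} {zero}  _         ()
empty-unset {suc m} {suc i} (s≤s i<m) = empty-unset i<m

-- A grid is a vector of bit columns; a cell (i , w) is row i of column w.
Grid : ℕ → ℕ → Set
Grid m k = Vec (Vec Bool m) k

-- Reading and marking a cell of a grid; cells outside the grid read as covered.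
covered : ∀ {m k} → Grid m k → Cell → Bool
covered []         _           = true
covered (col ∷ cs) (i , zero)  = isSet col i
covered (col ∷ cs) (i , suc w) = covered cs (i , w)

cover : ∀ {m k} → Grid m k → Cell → Grid m k
cover []         _           = []
cover (col ∷ cs) (i , zero)  = setBit col i ∷ cs
cover (col ∷ cs) (i , suc w) = col ∷ cover cs (i , w)

cover-self : ∀ {m k} (s : Grid m k) x → covered (cover s x) x ≡ true
cover-self []         _           = refl
cover-self (col ∷ cs) (i , zero)  = setBit-self col i
cover-self (col ∷ cs) (i , suc w) = cover-self cs (i , w)

cover-keep : ∀ {m k} (s : Grid m k) x y → covered s y ≡ true → covered (cover s x) y ≡ true
cover-keep []         _           _           set = refl
cover-keep (col ∷ cs) (p , zero)  (i , zero)  set = setBit-keep col p i set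
cover-keep (col ∷ cs) (p , zero)  (i , suc w) set = set
cover-keep (col ∷ cs) (p , suc q) (i , zero)  set = set
cover-keep (col ∷ cs) (p , suc q) (i , suc w) set = cover-keep cs (p , q) (i , w) set

cover-new : ∀ {m k} (s : Grid m k) x y → covered (cover s x) y ≡ true → covered s y ≡ true ⊎ y ≡ x
cover-new []         _           _           set = inj₁ refl
cover-new (col ∷ cs) (p , zero)  (i , zero)  set = map₂ (cong (_, zero)) (setBit-new col p i set)
cover-new (col ∷ cs) (p , zero)  (i , suc w) set = inj₁ set
cover-new (col ∷ cs) (p , suc q) (i , zero)  set = inj₁ set
cover-new (col ∷ cs) (p , suc q) (i , suc w) set =
  map₂ (cong (λ { (i , w) → (i , suc w) })) (cover-new cs (p , q) (i , w) set)

coverAll : ∀ {m k} → Grid m k → List Cell → Grid m k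
coverAll s []       = s
coverAll s (x ∷ xs) = coverAll (cover s x) xs

allFree : ∀ {m k} → Grid m k → List Cell → Bool
allFree s []       = true
allFree s (x ∷ xs) = not (covered s x) ∧ allFree s xs

coverAll-new : ∀ {m k} (s : Grid m k) xs y → covered (coverAll s xs) y ≡ true → covered s y ≡ true ⊎ y ∈ xs
coverAll-new s []       y set = inj₁ set
coverAll-new s (x ∷ xs) y set with coverAll-new (cover s x) xs y set
... | inj₂ y∈xs = inj₂ (there y∈xs)
... | inj₁ set′ with cover-new s x y set′
...   | inj₁ set″ = inj₁ set″
...   | inj₂ refl = inj₂ (here refl)

coverAll-keep : ∀ {m k} (s : Grid m k) xs y → covered s y ≡ true ⊎ y ∈ xs → covered (coverAll s xs) y ≡ true
coverAll-keep s []       y (inj₁ set)           = set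
coverAll-keep s (x ∷ xs) y (inj₁ set)           = coverAll-keep (cover s x) xs y (inj₁ (cover-keep s x y set))
coverAll-keep s (x ∷ xs) y (inj₂ (here refl))   = coverAll-keep (cover s x) xs y (inj₁ (cover-self s x))
coverAll-keep s (x ∷ xs) y (inj₂ (there y∈xs)) = coverAll-keep (cover s x) xs y (inj₂ y∈xs)

allFree-intro : ∀ {m k} (s : Grid m k) xs → (∀ {y} → y ∈ xs → covered s y ≡ false) → allFree s xs ≡ true
allFree-intro s []       free = refl
allFree-intro s (x ∷ xs) free rewrite free (here refl) = allFree-intro s xs (λ y∈ → free (there y∈))

-- Candidate tetrominos in window coordinates for covering the free cell (r , 2).
-- A tetromino covering (r , 2) is determined by its orientation and by which of
-- its offsets lands on (r , 2).  In the first column of the box a tile may stick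
-- in from the left; later every tile covering the current column starts there.
anchor : Orientation → Cell → Cell → Tile
anchor o (dr , dc) (r , c) = tee o (r ∸ dr , c ∸ dc)

-- Which offsets d = (dr , dc) may land on (r , 2): the corner row r - dr must exist,
-- and unless in the first column the tile must start in column 2 (dc ≡ 0).
Fits : Bool → ℕ → Cell → Set
Fits true  r (dr , dc) = dr ≤ r
Fits false r (dr , dc) = dc ≡ 0 × dr ≤ r

fits? : ∀ first r → Decidable (Fits first r)
fits? true  r (dr , dc) = dr ≤? r
fits? false r (dr , dc) = (dc ≟ 0) ×-dec (dr ≤? r)

orientations : List Orientation
orientations = stemDown ∷ stemUp ∷ stemRight ∷ stemLeft ∷ []

anchorings : Bool → ℕ → Orientation → List Tile
anchorings first r o = map (λ d → anchor o d (r , 2)) (filter (fits? first r) (offsets o))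

candidates : Bool → ℕ → List Tile
candidates first r = concatMap (anchorings first r) orientations

candidate-complete : ∀ first o r0 c0 {r} → (r , 2) ∈ cells (tee o (r0 , c0)) →
  (first ≡ false → c0 ≡ 2) → tee o (r0 , c0) ∈ candidates first r
candidate-complete first o r0 c0 x∈ starts with ∈-tee⁻ o (r0 , c0) x∈
... | (dr , dc) , d∈ , at-d with cong proj₁ at-d | cong proj₂ at-d
...   | refl | at-col =
  ∈-concatMap⁺ (anchorings first r) (lose (orientation∈ o) (subst (_∈ anchorings first r o) anchored
    (∈-map⁺ (λ d → anchor o d (r , 2)) (∈-filter⁺ (fits? first r) d∈ (fits first starts)))))
  where
  r = dr + r0
  anchored : anchor o (dr , dc) (dr + r0 , 2) ≡ tee o (r0 , c0)
  anchored = cong₂ (λ r c → tee o (r , c)) (m+n∸m≡n dr r0) (trans (cong (_∸ dc) at-col) (m+n∸m≡n dc c0))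
  fits : ∀ first → (first ≡ false → c0 ≡ 2) → Fits first (dr + r0) (dr , dc)
  fits true  _      = m≤m+n dr r0
  fits false starts = +-cancelʳ-≡ 2 dc 0 (trans (cong (dc +_) (sym (starts refl))) (sym at-col)) , m≤m+n dr r0
  orientation∈ : ∀ o → o ∈ orientations
  orientation∈ stemDown  = here refl
  orientation∈ stemUp    = there (here refl)
  orientation∈ stemRight = there (there (here refl))
  orientation∈ stemLeft  = there (there (there (here refl)))

-- Binary tries: finite sets of bit vectors of a fixed length, used to remove
-- duplicate profiles between steps.
data BitSet : ℕ → Set where
  ∅    : ∀ {n} → BitSet n
  ⋆    : BitSet zero
  node : ∀ {n} → BitSet n → BitSet n → BitSet (suc n)

data _∈ᵇ_ : ∀ {n} → Vec Bool n → BitSet n → Set where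
  stop  : [] ∈ᵇ ⋆
  left  : ∀ {n v} {l r : BitSet n} → v ∈ᵇ l → (false ∷ v) ∈ᵇ node l r
  right : ∀ {n v} {l r : BitSet n} → v ∈ᵇ r → (true ∷ v) ∈ᵇ node l r

insert : ∀ {n} → Vec Bool n → BitSet n → BitSet n
insert []          _          = ⋆
insert (false ∷ v) ∅          = node (insert v ∅) ∅
insert (true ∷ v)  ∅          = node ∅ (insert v ∅)
insert (false ∷ v) (node l r) = node (insert v l) r
insert (true ∷ v)  (node l r) = node l (insert v r)

elements : ∀ {n} → BitSet n → List (Vec Bool n)
elements ∅          = []
elements ⋆          = [] ∷ []
elements (node l r) = map (false ∷_) (elements l) ++ map (true ∷_) (elements r)

insert-self : ∀ {n} (v : Vec Bool n) s → v ∈ᵇ insert v s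
insert-self []          _          = stop
insert-self (false ∷ v) ∅          = left (insert-self v ∅)
insert-self (true ∷ v)  ∅          = right (insert-self v ∅)
insert-self (false ∷ v) (node l r) = left (insert-self v l)
insert-self (true ∷ v)  (node l r) = right (insert-self v r)

insert-keep : ∀ {n} (v : Vec Bool n) {u s} → u ∈ᵇ s → u ∈ᵇ insert v s
insert-keep []          stop      = stop
insert-keep (false ∷ v) (left u∈)  = left (insert-keep v u∈)
insert-keep (true ∷ v)  (left u∈)  = left u∈
insert-keep (false ∷ v) (right u∈) = right u∈
insert-keep (true ∷ v)  (right u∈) = right (insert-keep v u∈)

elements-complete : ∀ {n} {u : Vec Bool n} {s} → u ∈ᵇ s → u ∈ elements s
elements-complete stop = here refl
elements-complete {s = node l r} (left u∈) =
  ∈-++⁺ˡ (∈-map⁺ (false ∷_) (elements-complete u∈))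
elements-complete {s = node l r} (right u∈) =
  ∈-++⁺ʳ (map (false ∷_) (elements l)) (∈-map⁺ (true ∷_) (elements-complete u∈))

fromList : ∀ {n} → List (Vec Bool n) → BitSet n
fromList = foldr insert ∅

fromList-complete : ∀ {n} {v : Vec Bool n} {vs} → v ∈ vs → v ∈ᵇ fromList vs
fromList-complete {vs = v ∷ vs} (here refl) = insert-self v (fromList vs)
fromList-complete {vs = w ∷ vs} (there v∈)  = insert-keep w (fromList-complete v∈)

-- Profiles are stored in the trie as the concatenation of their two columns.
halves : ∀ {A : Set} m {n} → Vec A (m + n) → Vec A m × Vec A n
halves m v = proj₁ (splitAt m v) , proj₁ (proj₂ (splitAt m v))

halves-++ : ∀ {A : Set} {m n} (a : Vec A m) (b : Vec A n) → halves m (a ++ᵛ b) ≡ (a , b)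
halves-++ {m = m} a b with splitAt m (a ++ᵛ b)
... | a' , b' , eq = cong₂ _,_ (sym (++-injectiveˡ a a' eq)) (sym (++-injectiveʳ a a' eq))

-- The search itself, for boards with a given number of rows.  Its state between
-- two columns is a profile; while a column is covered it is a window of five columns.
module ColumnSearch (rows : ℕ) where

  Column : Set
  Column = Vec Bool rows

  emptyColumn : Column
  emptyColumn = replicate rows false

  -- The window around the current column b: five columns b-2 .. b+2,
  -- so window column w lies over board column c exactly when w + b ≡ c + 2.
  Window : Set
  Window = Grid rows 5

  -- The state between two columns: which cells of the current column and of the
  -- next one are already covered.
  Profile : Set
  Profile = Column × Column

  nextProfile : Window → Profile
  nextProfile (_ ∷ _ ∷ _ ∷ a ∷ b ∷ []) = (a , b)

  mutual
    fillFrom : Bool → ℕ → ℕ → Window → List Profile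
    fillFrom first zero    r s = nextProfile s ∷ []
    fillFrom first (suc m) r s =
      if covered s (r , 2) then fillFrom first m (suc r) s
      else concatMap (tryTile first m r s) (candidates first r)

    tryTile : Bool → ℕ → ℕ → Window → Tile → List Profile
    tryTile first m r s t =
      if allFree s (cells t) then fillFrom first m (suc r) (coverAll s (cells t)) else []

  initialWindow : Profile → Window
  initialWindow (a , b) = emptyColumn ∷ emptyColumn ∷ a ∷ b ∷ emptyColumn ∷ []

  tryTile-free : ∀ first m r s t → allFree s (cells t) ≡ true →
    tryTile first m r s t ≡ fillFrom first m (suc r) (coverAll s (cells t))
  tryTile-free first m r s t free rewrite free = refl

  fill : Bool → Profile → List Profile
  fill first p = fillFrom first rows 0 (initialWindow p)

  joinProfile : Profile → Vec Bool (rows + rows)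
  joinProfile (a , b) = a ++ᵛ b

  dedup : List Profile → List Profile
  dedup ps = map (halves rows) (elements (fromList (map joinProfile ps)))

  dedup-complete : ∀ {p ps} → p ∈ ps → p ∈ dedup ps
  dedup-complete {p@(a , b)} p∈ =
    subst (_∈ _) (halves-++ a b)
      (∈-map⁺ (halves rows) (elements-complete (fromList-complete (∈-map⁺ joinProfile p∈))))

  -- reachable k over-approximates the profiles that can occur before column k of the box.
  reachable : ℕ → List Profile
  reachable zero    = (emptyColumn , emptyColumn) ∷ []
  reachable (suc k) = dedup (concatMap (fill (k ≡ᵇ 0)) (reachable k))

record Aligned (b w c : ℕ) : Set where
  constructor aligned
  field offset : w + b ≡ c + 2

aligned-unique : ∀ {b w c c'} → Aligned b w c → Aligned b w c' → c ≡ c'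
aligned-unique (aligned e) (aligned e') = +-cancelʳ-≡ 2 _ _ (trans (sym e) e')

aligned-unique-w : ∀ {b w w' c} → Aligned b w c → Aligned b w' c → w ≡ w'
aligned-unique-w {b} (aligned e) (aligned e') = +-cancelʳ-≡ b _ _ (trans e (sym e'))

aligned-canonical : ∀ d b → Aligned b (2 + d) (d + b)
aligned-canonical d b = aligned (+-comm 2 (d + b))

-- Soundness of the search: following an actual tiling whose box of width len, from
-- column j on, has no monomino, the search keeps a profile alive in every step.
module Scan {rows n ts} (T : IsTiling rows n ts) (j len : ℕ) (box : j + len ≤ n)
  (no-mono : ∀ {r c} → mono (r , c) ∈ ts → j ≤ c → c < j + len → ⊥) where

  open TilingFacts T
  open ColumnSearch rows

  -- The scan of the box handles its columns k + j for k = 0 , 1 , ... in turn.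
  -- Before step k the tiles starting left of column k + j are placed; before step 0
  -- none is: tiles entering the box from the left are placed during step 0.
  Placed : ℕ → Tile → Set
  Placed zero    t = ⊥
  Placed (suc k) t = leftCol t < suc k + j

  placed-left : ∀ k {t} → Placed k t → leftCol t < k + j
  placed-left (suc k) lt = lt

  placed-step : ∀ k {t} → Placed k t → Placed (suc k) t
  placed-step (suc k) lt = m<n⇒m<1+n lt

  -- During step k, once the rows above r of column k + j are handled, the placed
  -- tiles are the earlier ones and those meeting column k + j above row r.
  Active : ℕ → ℕ → Tile → Set
  Active k r t = Placed k t ⊎ ∃[ i ] i < r × (i , k + j) ∈ cells t

  active-start : ∀ {k t} → Active k 0 t → Placed k t
  active-start (inj₁ p) = p

  active-mono : ∀ {k r t} → Active k r t → Active k (suc r) t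
  active-mono (inj₁ p)              = inj₁ p
  active-mono (inj₂ (i , i<r , i∈)) = inj₂ (i , m<n⇒m<1+n i<r , i∈)

  active-step : ∀ {k r t} → Active k (suc r) t → Active k r t ⊎ (r , k + j) ∈ cells t
  active-step (inj₁ p) = inj₁ (inj₁ p)
  active-step (inj₂ (i , i<1+r , i∈)) with m<1+n⇒m<n∨m≡n i<1+r
  ... | inj₁ i<r  = inj₁ (inj₂ (i , i<r , i∈))
  ... | inj₂ refl = inj₂ i∈

  CoveredBy : (Tile → Set) → Cell → Set
  CoveredBy P x = ∃[ t ] t ∈ ts × x ∈ cells t × P t

  weaken : ∀ {P Q : Tile → Set} {x} → (∀ {t} → P t → Q t) → CoveredBy P x → CoveredBy Q x
  weaken f (t , t∈ , x∈ , p) = t , t∈ , x∈ , f p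

  active-placed : ∀ k {i c} → k + j ≤ c → CoveredBy (Active k rows) (i , c) ⇔ CoveredBy (Placed (suc k)) (i , c)
  active-placed k k+j≤c = mk⇔ (weaken placed) (λ { (t , t∈ , x∈ , lt) → t , t∈ , x∈ , meets t∈ x∈ lt })
    where
    placed : ∀ {t} → Active k rows t → Placed (suc k) t
    placed (inj₁ p)              = placed-step k p
    placed (inj₂ (_ , _ , i∈))   = s≤s (proj₁ (col-bounds _ i∈))
    meets : ∀ {t i} → t ∈ ts → (i , _) ∈ cells t → Placed (suc k) t → Active k rows t
    meets {t} t∈ x∈ lt with spans t (k + j) x∈ (≤-pred lt) k+j≤c
    ... | i' , i'∈ = inj₂ (i' , proj₁ (tile-inside t∈ i'∈) , i'∈)

  Represents : ℕ → Profile → Set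
  Represents k (a , b) = ∀ {i} → i < rows →
      (isSet a i ≡ true ⇔ CoveredBy (Placed k) (i , k + j))
    × (isSet b i ≡ true ⇔ CoveredBy (Placed k) (i , suc (k + j)))

  WindowInv : ℕ → ℕ → Window → Set
  WindowInv k r s = ∀ {i w c} → i < rows → w < 5 → Aligned (k + j) w c →
      (covered s (i , w) ≡ true → CoveredBy (Active k r) (i , c))
    × (2 ≤ w → CoveredBy (Active k r) (i , c) → covered s (i , w) ≡ true)

  starts-here : ∀ k {t} → ¬ Placed k t → leftCol t ≤ k + j → (k ≡ᵇ 0) ≡ false → leftCol t ≡ k + j
  starts-here (suc k) not-placed left≤ _ = ≤-antisym left≤ (≮⇒≥ not-placed)

  module Step (k : ℕ) (k<len : k < len) where
    b : ℕ
    b = k + j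

    first : Bool
    first = k ≡ᵇ 0

    b<n : b < n
    b<n = <-≤-trans (+-monoˡ-< j k<len) (subst (_≤ n) (+-comm j len) box)

    -- The window built from an exact profile is exact: columns 0 and 1 start unmarked,
    -- and column 4 correctly so, since no placed tile reaches column k + j + 2.
    inv-start : ∀ {p} → Represents k p → WindowInv k 0 (initialWindow p)
    inv-start rep {w = 0} i<rows _ _ = ⊥-elim ∘ empty-unset i<rows , λ ()
    inv-start rep {w = 1} i<rows _ _ = ⊥-elim ∘ empty-unset i<rows , λ { (s≤s ()) }
    inv-start {_ , _} rep {w = 2} {c} i<rows _ e with aligned-unique (aligned-canonical 0 b) e
    ... | refl = weaken inj₁ ∘ to (proj₁ (rep i<rows)) , λ _ → from (proj₁ (rep i<rows)) ∘ weaken active-start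
    inv-start {_ , _} rep {w = 3} {c} i<rows _ e with aligned-unique (aligned-canonical 1 b) e
    ... | refl = weaken inj₁ ∘ to (proj₂ (rep i<rows)) , λ _ → from (proj₂ (rep i<rows)) ∘ weaken active-start
    inv-start {_ , _} rep {w = 4} {c} i<rows _ e with aligned-unique (aligned-canonical 2 b) e
    ... | refl = ⊥-elim ∘ empty-unset i<rows , λ { _ (t , t∈ , x∈ , act) → ⊥-elim (beyond t x∈ (active-start act)) }
      where
      beyond : ∀ t {i} → (i , 2 + b) ∈ cells t → Placed k t → ⊥
      beyond t x∈ p = <-irrefl refl (≤-<-trans (proj₂ (col-bounds t x∈)) (+-monoʳ-< 2 (placed-left k p)))
    inv-start rep {w = suc (suc (suc (suc (suc _))))} _ (s≤s (s≤s (s≤s (s≤s (s≤s ()))))) _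

    2<5 : 2 < 5
    2<5 = s≤s (s≤s (s≤s z≤n))

    marked-if-active : ∀ {r s t} → r < rows → WindowInv k r s → t ∈ ts → (r , b) ∈ cells t →
      Active k r t → covered s (r , 2) ≡ true
    marked-if-active r<rows inv t∈ x∈ act =
      proj₂ (inv r<rows 2<5 (aligned-canonical 0 b)) ≤-refl (_ , t∈ , x∈ , act)

    active-if-marked : ∀ {r s t} → r < rows → WindowInv k r s → t ∈ ts → (r , b) ∈ cells t →
      covered s (r , 2) ≡ true → Active k r t
    active-if-marked r<rows inv t∈ x∈ set with proj₁ (inv r<rows 2<5 (aligned-canonical 0 b)) set
    ... | t' , t'∈ , x∈' , act with same-tile t∈ t'∈ x∈ x∈'
    ...   | refl = act

    inv-skip : ∀ {r s} → r < rows → covered s (r , 2) ≡ true → WindowInv k r s → WindowInv k (suc r) s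
    inv-skip {r} {s} r<rows set inv {i} {w} {c} i<rows w<5 e = weaken active-mono ∘ proj₁ (inv i<rows w<5 e) , complete
      where
      complete : 2 ≤ w → CoveredBy (Active k (suc r)) (i , c) → covered s (i , w) ≡ true
      complete 2≤w (t , t∈ , x∈ , act) with active-step act
      ... | inj₁ act′ = proj₂ (inv i<rows w<5 e) 2≤w (t , t∈ , x∈ , act′)
      ... | inj₂ top∈ =
        proj₂ (inv i<rows w<5 e) 2≤w (t , t∈ , x∈ , active-if-marked {s = s} r<rows inv t∈ top∈ set)

    module Fresh {r s} (r<rows : r < rows) (inv : WindowInv k r s) (o : Orientation) (r0 c0 : ℕ)
      (t∈ : tee o (r0 , c0) ∈ ts) (top∈ : (r , b) ∈ cells (tee o (r0 , c0)))
      (fresh : ¬ Active k r (tee o (r0 , c0))) where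

      t : Tile
      t = tee o (r0 , c0)

      c0≤b : c0 ≤ b
      c0≤b = proj₁ (col-bounds t top∈)

      b≤2+c0 : b ≤ 2 + c0
      b≤2+c0 = proj₂ (col-bounds t top∈)

      -- the window column of the tile's leftmost column
      c0' : ℕ
      c0' = 2 + c0 ∸ b

      t' : Tile
      t' = tee o (r0 , c0')

      shift : c0' + b ≡ c0 + 2
      shift = trans (m∸n+n≡m b≤2+c0) (+-comm 2 c0)

      to-window : ∀ {i c} → (i , c) ∈ cells t → ∃[ w ] (i , w) ∈ cells t' × Aligned b w c
      to-window c∈ with shift-tee o r0 shift c∈
      ... | w , w∈ , e = w , w∈ , aligned e

      to-board : ∀ {i w} → (i , w) ∈ cells t' → ∃[ c ] (i , c) ∈ cells t × Aligned b w c
      to-board w∈ with shift-tee o r0 (sym shift) w∈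
      ... | c , c∈ , e = c , c∈ , aligned (sym e)

      in-window : ∀ {i w} → (i , w) ∈ cells t' → w < 5
      in-window w∈ = s≤s (≤-trans (proj₂ (col-bounds t' w∈)) (+-monoʳ-≤ 2 c0'≤2))
        where
        c0'≤2 : c0' ≤ 2
        c0'≤2 = ≤-trans (∸-monoˡ-≤ b (+-monoʳ-≤ 2 c0≤b)) (≤-reflexive (m+n∸n≡m 2 b))

      candidate : t' ∈ candidates first r
      candidate = candidate-complete first o r0 c0' top' starts
        where
        top' : (r , 2) ∈ cells t'
        top' with to-window top∈
        ... | w , w∈ , e with aligned-unique-w e (aligned-canonical 0 b)
        ...   | refl = w∈
        starts : first ≡ false → c0' ≡ 2
        starts later = trans (cong (λ c → 2 + c ∸ b) (starts-here k (fresh ∘ inj₁) c0≤b later)) (m+n∸n≡m 2 b)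

      -- none of its cells is marked, as marked cells belong to active tiles
      free : allFree s (cells t') ≡ true
      free = allFree-intro s (cells t') (λ w∈ → ¬-not (marked w∈))
        where
        marked : ∀ {i w} → (i , w) ∈ cells t' → covered s (i , w) ≢ true
        marked w∈ set with to-board w∈
        ... | c , c∈ , e with proj₁ (inv (proj₁ (tile-inside t∈ c∈)) (in-window w∈) e) set
        ...   | t₂ , t₂∈ , c∈₂ , act with same-tile t∈ t₂∈ c∈ c∈₂
        ...     | refl = fresh act

      inv-place : WindowInv k (suc r) (coverAll s (cells t'))
      inv-place {i} {w} {c} i<rows w<5 e = sound , complete
        where
        sound : covered (coverAll s (cells t')) (i , w) ≡ true → CoveredBy (Active k (suc r)) (i , c)
        sound set with coverAll-new s (cells t') (i , w) set
        ... | inj₁ set′ = weaken active-mono (proj₁ (inv i<rows w<5 e) set′)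
        ... | inj₂ w∈ with to-board w∈
        ...   | c′ , c′∈ , e′ with aligned-unique e′ e
        ...     | refl = t , t∈ , c′∈ , inj₂ (r , ≤-refl , top∈)
        complete : 2 ≤ w → CoveredBy (Active k (suc r)) (i , c) → covered (coverAll s (cells t')) (i , w) ≡ true
        complete 2≤w (t₂ , t₂∈ , x∈ , act) with active-step act
        ... | inj₁ act′ = coverAll-keep s (cells t') (i , w) (inj₁ (proj₂ (inv i<rows w<5 e) 2≤w (t₂ , t₂∈ , x∈ , act′)))
        ... | inj₂ top₂ with same-tile t∈ t₂∈ top∈ top₂
        ...   | refl with to-window x∈
        ...     | w′ , w′∈ , e′ with aligned-unique-w e′ e
        ...       | refl = coverAll-keep s (cells t') (i , w) (inj₂ w′∈)

    place-tile : ∀ {r s} → r < rows → WindowInv k r s → covered s (r , 2) ≡ false →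
      ∃[ t' ] t' ∈ candidates first r × allFree s (cells t') ≡ true × WindowInv k (suc r) (coverAll s (cells t'))
    place-tile {r} {s} r<rows inv unset with tile-at (r<rows , b<n)
    ... | mono _ , t∈ , here refl = ⊥-elim (no-mono t∈ (m≤n+m j k) (subst (b <_) (+-comm len j) (+-monoˡ-< j k<len)))
    ... | tee o (r0 , c0) , t∈ , top∈ = t' , candidate , free , inv-place
      where
      fresh : ¬ Active k r (tee o (r0 , c0))
      fresh act with trans (sym unset) (marked-if-active {s = s} r<rows inv t∈ top∈ act)
      ... | ()
      open Fresh {s = s} r<rows inv o r0 c0 t∈ top∈ fresh

    inv-finish : ∀ {s} → WindowInv k rows s → Represents (suc k) (nextProfile s)
    inv-finish {s@(_ ∷ _ ∷ _ ∷ _ ∷ _ ∷ [])} inv {i} i<rows =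
      exact (aligned-canonical 1 b) (s≤s (s≤s z≤n)) (s≤s (s≤s (s≤s (s≤s z≤n)))) (n≤1+n b) ,
      exact (aligned-canonical 2 b) (s≤s (s≤s z≤n)) ≤-refl (m≤n+m b 2)
      where
      exact : ∀ {w c} → Aligned b w c → 2 ≤ w → w < 5 → b ≤ c →
        (covered s (i , w) ≡ true) ⇔ CoveredBy (Placed (suc k)) (i , c)
      exact e 2≤w w<5 b≤c = mk⇔ (to (active-placed k b≤c) ∘ proj₁ (inv i<rows w<5 e))
                                (proj₂ (inv i<rows w<5 e) 2≤w ∘ from (active-placed k b≤c))

    row-left : ∀ {m r} → suc m + r ≡ rows → r < rows
    row-left {m} {r} eq = subst (r <_) eq (s≤s (m≤n+m r m))

    fill-complete : ∀ m r s → m + r ≡ rows → WindowInv k r s →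
      ∃[ p ] p ∈ fillFrom first m r s × Represents (suc k) p
    fill-complete zero r s refl inv = nextProfile s , here refl , inv-finish {s} inv
    fill-complete (suc m) r s eq inv with covered s (r , 2) in e
    ... | true  = fill-complete m (suc r) s (trans (+-suc m r) eq) (inv-skip {s = s} (row-left eq) e inv)
    ... | false with place-tile {s = s} (row-left eq) inv e
    ...   | t' , t'∈ , free , inv′ with fill-complete m (suc r) (coverAll s (cells t')) (trans (+-suc m r) eq) inv′
    ...     | p , p∈ , rep = p , ∈-concatMap⁺ (tryTile first m r s) (lose t'∈ tried) , rep
      where
      tried : p ∈ tryTile first m r s t'
      tried = subst (p ∈_) (sym (tryTile-free first m r s t' free)) p∈

    step-complete : ∀ {p} → Represents k p → ∃[ p' ] p' ∈ fill first p × Represents (suc k) p'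
    step-complete rep = fill-complete rows 0 _ (+-identityʳ rows) (inv-start rep)

  start-exact : Represents 0 (emptyColumn , emptyColumn)
  start-exact i<rows = never , never
    where
    never : ∀ {c} → (isSet emptyColumn _ ≡ true) ⇔ CoveredBy (Placed 0) (_ , c)
    never = mk⇔ (⊥-elim ∘ empty-unset i<rows) (λ ())

  reach : ∀ k → k ≤ len → ∃[ p ] p ∈ reachable k × Represents k p
  reach zero    _     = (emptyColumn , emptyColumn) , here refl , start-exact
  reach (suc k) k<len with reach k (<⇒≤ k<len)
  ... | p , p∈ , rep with Step.step-complete k k<len rep
  ...   | p' , p'∈ , rep' = p' , dedup-complete (∈-concatMap⁺ (fill (k ≡ᵇ 0)) (lose p∈ p'∈)) , rep'

  -- Hence a box of width len without monomino is impossible once the search dies out.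
  -- (The hypothesis names ColumnSearch.reachable itself rather than the copy opened
  -- above, so that instantiating it with a computed fact needs no evaluation.)
  dies-out : ColumnSearch.reachable rows len ≡ [] → ⊥
  dies-out none with reach len ≤-refl
  ... | p , p∈ , _ with subst (p ∈_) none p∈
  ...   | ()

MonoInBox : ℕ → Tile → Set
MonoInBox j (mono (_ , c)) = j ≤ c × c < j + 17
MonoInBox j (tee _ _)      = ⊥

mono-in-box? : ∀ j → Decidable (MonoInBox j)
mono-in-box? j (mono (_ , c)) = (j ≤? c) ×-dec (c <? j + 17)
mono-in-box? j (tee _ _)      = no λ ()

no-survivors : ColumnSearch.reachable 9 17 ≡ []
no-survivors = refl

lemma2 : (n : ℕ) → 17 ≤ n → (ts : List Tile) → IsTiling 9 n ts →
    (j : ℕ) → j + 17 ≤ n →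
    ∃[ r ] ∃[ c ] (mono (r , c) ∈ ts × j ≤ c × c < j + 17)
lemma2 n _ ts T j box with any? (mono-in-box? j) ts
... | yes found with find found
...   | mono (r , c) , m∈ , in-box = r , c , m∈ , in-box
...   | tee _ _      , _  , ()
lemma2 n _ ts T j box | no none =
  ⊥-elim (Scan.dies-out T j 17 box (λ m∈ lo hi → none (lose m∈ (lo , hi))) no-survivors)
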